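{- (Provably in $\mathrm{EA}$.) For every natural number $n$, if $h_{1111}(n)$ is defined then $h_{1111}(n)>2^n_n$ and $h_{111}(n)>2^n$.
   Context: Superexponentiation: $2^x_0=x$, $2^x_{k+1}=2^{2^x_k}$. Worms are finite sequences of ordinals (here natural numbers); $1111$ and $111$ denote the worms consisting of four resp. three entries $1$; $\top$ is the empty worm; $C^k$ is $k$-fold concatenation. $h_\alpha(\top)=\top$, $h_\alpha(\beta A)=\top$ if $\beta<\alpha$, else $\beta h_\alpha(A)$; $r_\alpha(\top)=\top$, $r_\alpha(\beta A)=\beta A$ if $\beta<\alpha$, else $r_\alpha(A)$. Step-down: $\top\llbracket k\rrbracket=\top$, $(0B)\llbracket k\rrbracket=B$, $((\alpha+1)B)\llbracket k\rrbracket=(\alpha\,h_{\alpha+1}(B))^{k+1}r_{\alpha+1}(B)$. $h_A(m)$ is the least $k$ with $A\llbracket m\rrbracket\llbracket m+1\rrbracket\cdots\llbracket m+k\rrbracket=\top$ (undefined if none). -}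

module Defs where

open import Data.Nat using (ℕ; zero; suc; _<ᵇ_; _^_; _<_)
open import Data.List using (List; []; _∷_; _++_)
open import Data.Bool using (if_then_else_)
open import Data.Product using (_×_)
open import Relation.Binary.PropositionalEquality using (_≡_; _≢_)

superexp : ℕ → ℕ → ℕ
superexp x zero    = x
superexp x (suc k) = 2 ^ superexp x k

-- Worms: finite sequences of natural numbers; ⊤ is the empty list.
Worm : Set
Worm = List ℕ

hd : ℕ → Worm → Worm
hd α []      = []
hd α (β ∷ A) = if β <ᵇ α then [] else β ∷ hd α A

rm : ℕ → Worm → Worm
rm α []      = []
rm α (β ∷ A) = if β <ᵇ α then β ∷ A else rm α A

rep : ℕ → Worm → Worm
rep zero    C = []
rep (suc k) C = C ++ rep k C

step : Worm → ℕ → Worm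
step []            k = []
step (zero ∷ B)    k = B
step (suc α ∷ B)   k = rep (suc k) (α ∷ hd (suc α) B) ++ rm (suc α) B

steps : Worm → ℕ → ℕ → Worm
steps A m zero    = A
steps A m (suc j) = steps (step A m) (suc m) j

-- IsH A m k : "h_A(m) = k", i.e. k is least with A⟦m⟧⟦m+1⟧⋯⟦m+k⟧ = ⊤
IsH : Worm → ℕ → ℕ → Set
IsH A m k = (steps A m (suc k) ≡ []) × (∀ j → j < k → steps A m (suc j) ≢ [])

w1111 : Worm
w1111 = 1 ∷ 1 ∷ 1 ∷ 1 ∷ []

w111 : Worm
w111 = 1 ∷ 1 ∷ 1 ∷ []

-- For a worm R that is ⊤ or starts with 0, let exit a m be the stage at which 1^a R,
-- stepped down from stage m on, has become R.  At stage m, 1^(a+1) R steps down to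
-- (0 1^a)^(m+1) R, and a block 0 1^a entered at stage x is used up at stage
-- exit a (x+1) without ⊤ appearing in between; so exit (a+1) m is the (m+1)-fold
-- iterate of x ↦ exit a (x+1) at m+1, and h_{1^(a+1)}(m) + m + 1 = exit (a+1) m.
-- Already exit 3 m ≥ 2^(m+3) and exit 4 m ≥ 2^(2^m_m + 3).
module Submission where

open import Defs
open import Data.Nat using (ℕ; zero; suc; _+_; _*_; _^_; _≤_; _<_; z≤n; s≤s; s≤s⁻¹)
open import Data.Product using (_×_; ∃; _,_)
open import Data.Nat.GeneralisedArithmetic using (fold; iterate; iterate-is-fold)
open import Data.Nat.Properties
open import Data.Nat.Tactic.RingSolver using (solve-∀)
open import Data.List using ([]; _∷_; _++_)
open import Data.List.Properties using (++-assoc; ++-identityʳ)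
open import Data.Empty using (⊥-elim)
open import Function using (_∘_)
open import Relation.Binary.Definitions using (tri<; tri≈; tri>)
open import Relation.Binary.PropositionalEquality

private
  variable
    A B C R : Worm
    k k′ m n p x y z : ℕ

data Reaches : Worm → ℕ → Worm → ℕ → Set where
  done : Reaches A m A m
  next : A ≢ [] → Reaches (step A m) (suc m) B n → Reaches A m B n

Reaches-trans : Reaches A m B n → Reaches B n C p → Reaches A m C p
Reaches-trans done         r = r
Reaches-trans (next ne r₁) r = next ne (Reaches-trans r₁ r)

Reaches⇒steps : Reaches A m B n →
  ∃ λ j → m + j ≡ n × steps A m j ≡ B × (∀ i → i < j → steps A m i ≢ [])
Reaches⇒steps {m = m} done = 0 , +-identityʳ m , refl , λ _ ()
Reaches⇒steps {A = A} {m = m} (next ne r) with Reaches⇒steps r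
... | j , e , s , ne′ = suc j , trans (+-suc m j) e , s , nonempty
  where
    nonempty : ∀ i → i < suc j → steps A m i ≢ []
    nonempty zero    _         = ne
    nonempty (suc i) (s≤s i<j) = ne′ i i<j

Reaches-[]⇒IsH : A ≢ [] → Reaches A m [] n → ∃ λ k → suc (m + k) ≡ n × IsH A m k
Reaches-[]⇒IsH ne done         = ⊥-elim (ne refl)
Reaches-[]⇒IsH ne (next _ r) = Reaches⇒steps r

IsH-unique : IsH A m k → IsH A m k′ → k ≡ k′
IsH-unique {k = k} {k′ = k′} (e , ne) (e′ , ne′) with <-cmp k k′
... | tri< k<k′ _ _ = ⊥-elim (ne′ k k<k′ e)
... | tri≈ _ k≡k′ _ = k≡k′
... | tri> _ _ k′<k = ⊥-elim (ne k′ k′<k e′)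

ones : ℕ → Worm
ones zero    = []
ones (suc a) = 1 ∷ ones a

data Low : Worm → Set where
  low-[] : Low []
  low-0∷ : ∀ B → Low (0 ∷ B)

hd-ones : ∀ a → Low R → hd 1 (ones a ++ R) ≡ ones a
hd-ones zero    low-[]     = refl
hd-ones zero    (low-0∷ B) = refl
hd-ones (suc a) lowR       = cong (1 ∷_) (hd-ones a lowR)

rm-ones : ∀ a → Low R → rm 1 (ones a ++ R) ≡ R
rm-ones zero    low-[]     = refl
rm-ones zero    (low-0∷ B) = refl
rm-ones (suc a) lowR       = rm-ones a lowR

step-ones : ∀ a → Low R → step (ones (suc a) ++ R) m ≡ rep (suc m) (0 ∷ ones a) ++ R
step-ones {m = m} a lowR =
  cong₂ (λ H T → rep (suc m) (0 ∷ H) ++ T) (hd-ones a lowR) (rm-ones a lowR)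

Low-rep : ∀ c → Low R → Low (rep c (0 ∷ C) ++ R)
Low-rep zero    lowR = lowR
Low-rep (suc c) _    = low-0∷ _

blocks-reach : (f : ℕ → ℕ) → (∀ x {R} → Low R → Reaches (C ++ R) x R (f x)) →
  ∀ c x → Low R → Reaches (rep c (0 ∷ C) ++ R) x R (iterate (f ∘ suc) x c)
blocks-reach f reach zero    x lowR = done
blocks-reach {C = C} {R = R} f reach (suc c) x lowR =
  next (λ ()) (Reaches-trans first (blocks-reach f reach c (f (suc x)) lowR))
  where
    rest : Worm
    rest = rep c (0 ∷ C) ++ R

    first : Reaches ((C ++ rep c (0 ∷ C)) ++ R) (suc x) rest (f (suc x))
    first = subst (λ W → Reaches W (suc x) rest (f (suc x)))
                  (sym (++-assoc C (rep c (0 ∷ C)) R))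
                  (reach (suc x) (Low-rep c lowR))

exit : ℕ → ℕ → ℕ
exit zero    m = m
exit (suc a) m = iterate (λ x → exit a (suc x)) (suc m) (suc m)

ones-reach : ∀ a m → Low R → Reaches (ones a ++ R) m R (exit a m)
ones-reach zero    m lowR = done
ones-reach {R = R} (suc a) m lowR =
  next (λ ()) (subst (λ W → Reaches W (suc m) R (exit (suc a) m))
                     (sym (step-ones {m = m} a lowR))
                     (blocks-reach (exit a) (λ x → ones-reach a x) (suc m) (suc m) lowR))

ones-IsH : ∀ a m → ∃ λ k → suc (m + k) ≡ exit (suc a) m × IsH (ones (suc a)) m k
ones-IsH a m = Reaches-[]⇒IsH (λ ())
  (subst (λ W → Reaches W m [] (exit (suc a) m))
         (++-identityʳ (ones (suc a)))
         (ones-reach (suc a) m low-[]))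

IsH-ones-> : ∀ a → suc (m + suc p) ≤ exit (suc a) m → IsH (ones (suc a)) m k → p < k
IsH-ones-> {m = m} a bound hk with ones-IsH a m
... | k′ , e , hk′ rewrite IsH-unique {A = ones (suc a)} hk hk′ =
  +-cancelˡ-≤ m _ _ (s≤s⁻¹ (subst (_ ≤_) (sym e) bound))

iterate-inflationary : ∀ {f} → (∀ y → y ≤ f y) → ∀ c x → x ≤ iterate f x c
iterate-inflationary     inf zero    x = ≤-refl
iterate-inflationary {f} inf (suc c) x = ≤-trans (inf x) (iterate-inflationary inf c (f x))

fold-mono : ∀ {f g} → (∀ y → g y ≤ f y) → (∀ {y z} → y ≤ z → g y ≤ g z) →
  ∀ c → x ≤ y → fold x g c ≤ fold y f c
fold-mono g≤f mono-g zero    x≤y = x≤y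
fold-mono g≤f mono-g (suc c) x≤y = ≤-trans (mono-g (fold-mono g≤f mono-g c x≤y)) (g≤f _)

fold-doubling : ∀ {f} → (∀ y → 2 * y ≤ f y) → ∀ c → 1 ≤ x → 2 ^ c ≤ fold x f c
fold-doubling dbl zero    1≤x = 1≤x
fold-doubling dbl (suc c) 1≤x = ≤-trans (*-monoʳ-≤ 2 (fold-doubling dbl c 1≤x)) (dbl _)

n<2^n : ∀ n → n < 2 ^ n
n<2^n zero    = s≤s z≤n
n<2^n (suc n) = +-mono-≤ (m^n>0 2 n) (≤-trans (n<2^n n) (m≤m+n _ 0))

superexp-inflationary : ∀ x k → x ≤ superexp x k
superexp-inflationary x zero    = ≤-refl
superexp-inflationary x (suc k) = ≤-trans (superexp-inflationary x k) (<⇒≤ (n<2^n _))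

superexp-is-fold : ∀ x k → superexp x k ≡ fold x (2 ^_) k
superexp-is-fold x zero    = refl
superexp-is-fold x (suc k) = cong (2 ^_) (superexp-is-fold x k)

exit-inflationary : ∀ a m → m ≤ exit a m
exit-inflationary zero    m = ≤-refl
exit-inflationary (suc a) m = ≤-trans (n≤1+n m)
  (iterate-inflationary (λ y → ≤-trans (n≤1+n y) (exit-inflationary a (suc y))) (suc m) (suc m))

iterate-strict : ∀ {f} → (∀ y → suc y ≤ f y) → ∀ c x → c + x ≤ iterate f x c
iterate-strict     f>id zero    x = ≤-refl
iterate-strict {f} f>id (suc c) x = begin
  suc c + x          ≡⟨ +-suc c x ⟨
  c + suc x          ≤⟨ +-monoʳ-≤ c (f>id x) ⟩
  c + f x            ≤⟨ iterate-strict f>id c (f x) ⟩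
  iterate f (f x) c  ∎
  where open ≤-Reasoning

exit-double : ∀ a m → 2 * m ≤ exit (suc a) m
exit-double a m = ≤-trans (+-mono-≤ (n≤1+n m) (≤-trans (≤-reflexive (+-identityʳ m)) (n≤1+n m)))
  (iterate-strict (λ y → exit-inflationary a (suc y)) (suc m) (suc m))

exit-exp : ∀ a m → 2 ^ suc m ≤ exit (2 + a) m
exit-exp a m = subst (2 ^ suc m ≤_) (iterate-is-fold (suc m) _ (suc m))
  (fold-doubling (λ y → ≤-trans (*-monoʳ-≤ 2 (n≤1+n y)) (exit-double a (suc y))) (suc m) (s≤s z≤n))

exit-exp₃ : ∀ a m → 2 ^ (3 + m) ≤ exit (3 + a) m
exit-exp₃ a m = ≤-trans (exit-exp a (2 + m))
  (iterate-inflationary (λ y → ≤-trans (n≤1+n y) (exit-inflationary (2 + a) (suc y))) m _)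

exit-tower : ∀ a m → 2 ^ (3 + superexp m m) ≤ exit (4 + a) m
exit-tower a m = begin
  2 ^ (3 + superexp m m)    ≤⟨ ^-monoʳ-≤ 2 (+-monoʳ-≤ 3 tower≤s) ⟩
  2 ^ (3 + s)               ≤⟨ ^-monoʳ-≤ 2 (n≤1+n (3 + s)) ⟩
  2 ^ (4 + s)               ≤⟨ exit-exp₃ a (suc s) ⟩
  fold (suc m) g (suc m)    ≡⟨ iterate-is-fold (suc m) g (suc m) ⟩
  exit (4 + a) m            ∎
  where
    open ≤-Reasoning
    g : ℕ → ℕ
    g y = exit (3 + a) (suc y)

    s : ℕ
    s = fold (suc m) g m

    tower≤s : superexp m m ≤ s
    tower≤s = subst (_≤ s) (sym (superexp-is-fold m m))
      (fold-mono (λ y → ≤-trans (^-monoʳ-≤ 2 (m≤n+m y 4)) (exit-exp₃ a (suc y)))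
                 (^-monoʳ-≤ 2) m (n≤1+n m))

x+z+2≤2^[3+y] : x ≤ y → z ≤ 2 ^ y → suc (x + suc z) ≤ 2 ^ (3 + y)
x+z+2≤2^[3+y] {x} {y} {z} x≤y z≤t = begin
  suc (x + suc z)          ≤⟨ +-mono-≤ (s≤s x≤y) (s≤s z≤t) ⟩
  suc y + suc t            ≤⟨ +-mono-≤ (n<2^n y) (+-monoˡ-≤ t (m^n>0 2 y)) ⟩
  t + (t + t)              ≤⟨ m≤m+n _ (5 * t) ⟩
  t + (t + t) + 5 * t      ≡⟨ split8 t ⟩
  2 ^ (3 + y)              ∎
  where
    open ≤-Reasoning
    t : ℕ
    t = 2 ^ y

    split8 : ∀ q → q + (q + q) + 5 * q ≡ 2 * (2 * (2 * q))
    split8 = solve-∀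

corollary6 : ∀ (n : ℕ) → ∃ (λ k → IsH w1111 n k) →
    (∀ k → IsH w1111 n k → superexp n n < k) × ∃ (λ k → IsH w111 n k × 2 ^ n < k)
corollary6 n _ = h1111> , h111>
  where
    h1111> : ∀ k → IsH w1111 n k → superexp n n < k
    h1111> k = IsH-ones-> {p = superexp n n} 3
      (≤-trans (x+z+2≤2^[3+y] (superexp-inflationary n n) (<⇒≤ (n<2^n _))) (exit-tower 0 n))

    h111> : ∃ λ k → IsH w111 n k × 2 ^ n < k
    h111> with ones-IsH 2 n
    ... | k , _ , hk =
      k , hk , IsH-ones-> 2 (≤-trans (x+z+2≤2^[3+y] ≤-refl ≤-refl) (exit-exp₃ 0 n)) hk
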